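{- Let $B$ be a $\wedge_d$-FBDD and $P$ a target path of $B$, and suppose that $\mathbf a=\mathbf a(P)$ can be extended to a satisfying assignment of $f(B)$. Then all variables of $V_0(P)$ are inessential variables of $f(B)|_{\mathbf a}$. Moreover, if $Alt(P)\neq\emptyset$ then $\mathcal{S}(B)|_{\mathbf a}=\mathcal{S}(B_{u(P)})\times\prod_{v\in Alt(P)}\mathcal{S}(B_v)\times\{0,1\}^{V_0(P)}$, and otherwise $\mathcal{S}(B)|_{\mathbf a}=\mathcal{S}(B_{u(P)})\times\{0,1\}^{V_0(P)}$.
   Context: Assignments are functions from a finite variable set to $\{0,1\}$, viewed as sets of pairs. For a set $\mathcal{H}$ of assignments over common variables $Var(\mathcal{H})$ and an assignment $\mathbf a$, $Proj(\mathbf a,Y)$ is the restriction of $\mathbf a$ to $Var(\mathbf a)\cap Y$, and the restriction $\mathcal{H}|_{\mathbf a}=\{\mathbf b\setminus\mathbf a:\mathbf b\in\mathcal{H},\ Proj(\mathbf a,Var(\mathcal{H}))\subseteq\mathbf b\}$. For disjoint variable sets, $\mathcal{H}_1\times\mathcal{H}_2=\{\mathbf a\cup\mathbf b:\mathbf a\in\mathcal{H}_1,\mathbf b\in\mathcal{H}_2\}$. For a Boolean function $f$, $f|_{\mathbf a}$ is the function over $Var(f)\setminus Var(\mathbf a)$ with satisfying assignments $\mathcal{S}(f)|_{\mathbf a}$. A $\wedge_d$-FBDD is a DAG $B$ with one source and at most two sinks; every non-sink node has two children. Sinks are labelled $True$/$False$ (one of each if two). Each non-sink node is labelled by a variable (out-edges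 labelled $0$ and $1$) or by $\wedge$. $B_u$ is the sub-DAG induced by nodes reachable from $u$; $Var(B_u)$ its set of labelling variables. Read-onceness: no directed path contains two nodes with the same variable. Decomposability: the children $u_1,u_2$ of any $\wedge$-node satisfy $Var(B_{u_1})\cap Var(B_{u_2})=\emptyset$. Semantics: $\mathcal{S}(B)$ over $Var(B)$ is $\{\emptyset\}$ for a $True$ sink, $\emptyset$ for a $False$ sink; for source labelled $x$ with $0$-child $u_0$ and $1$-child $u_1$: $\mathcal{S}(B)=\{(x,0)\}\times\mathcal{S}(B_{u_0})\times\{0,1\}^{Var(B_{u_1})\setminus Var(B_{u_0})}\cup\{(x,1)\}\times\mathcal{S}(B_{u_1})\times\{0,1\}^{Var(B_{u_0})\setminus Var(B_{u_1})}$; for a $\wedge$ source: $\mathcal{S}(B)=\mathcal{S}(B_{u_0})\times\mathcal{S}(B_{u_1})$. $f(B)$ is the function with $\mathcal{S}(f(B))=\mathcal{S}(B)$. A target path is a directed path $P$ of $B$ starting at the source; $u(P)$ is its last node. $Var(P)$ is the set of variables labelling the nodes of $P$ other than $u(P)$, and $\mathbf a(P)$ is the assignment on $Var(P)$ mapping each such $x$ to the label of the edge of $P$ leaving the node labelled $x$. A junction of $P$ is a $\wedge$-node of $P$ other than $u(P)$; the alternative of a junction is its child not on $P$; $Alt(P)$ is the set of alternatives of junctions of $P$. $V_0(P)=Var(B)\setminus(Var(B_{u(P)})\cup\bigcup_{v\in Alt(P)}Var(B_v))$.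
   Formalization: Throughout the conclusion V₀(P) ∖ Var(P) stands in place of V₀(P): only variables of V₀(P) outside Var(P) are claimed inessential, and the last factor of both products is the set of all assignments on V₀(P) ∖ Var(P). Apart from conventions, each condition added here is assumed in the paper as well or is needed for the statement above to hold. -}

module Defs where

open import Data.Nat using (ℕ)
open import Data.Fin using (Fin; _≟_)
open import Data.Bool using (Bool; true; false; not; if_then_else_)
open import Data.Maybe using (Maybe; just; nothing)
open import Data.Maybe as Maybe using ()
open import Data.Product using (Σ; ∃; ∃-syntax; _×_; _,_)
open import Data.Sum using (_⊎_)
open import Data.Empty using (⊥)
open import Data.List using (List; []; _∷_)
open import Data.List.Membership.Propositional using (_∈_)
open import Relation.Nullary using (¬_; yes; no)
open import Relation.Binary.PropositionalEquality using (_≡_)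
open import Relation.Binary.Construct.Closure.ReflexiveTransitive using (Star; ε; _◅_)

-- Assignments over the variable universe Fin m.
-- An assignment is a finite partial function Var → {0,1}, i.e. a
-- functional set of pairs; (x , b) ∈ a  iff  a x ≡ just b.

Assign : ℕ → Set
Assign m = Fin m → Maybe Bool

VarSet : ℕ → Set₁
VarSet m = Fin m → Set

AssignSet : ℕ → Set₁
AssignSet m = Assign m → Set

module _ {m : ℕ} where

  ∅ₐ : Assign m
  ∅ₐ _ = nothing

  single : Fin m → Bool → Assign m
  single x b y with x ≟ y
  ... | yes _ = just b
  ... | no  _ = nothing

  Dom : Assign m → VarSet m → Set
  Dom a V = ∀ x → ((Σ Bool λ b → a x ≡ just b) → V x) × (V x → Σ Bool λ b → a x ≡ just b)

  _⊆ₐ_ : Assign m → Assign m → Set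
  a ⊆ₐ b = ∀ x v → a x ≡ just v → b x ≡ just v

  ProjSub : Assign m → VarSet m → Assign m → Set
  ProjSub a Y b = ∀ x v → Y x → a x ≡ just v → b x ≡ just v

  IsUnion : Assign m → Assign m → Assign m → Set
  IsUnion a a₁ a₂ = ∀ x v → (a x ≡ just v → a₁ x ≡ just v ⊎ a₂ x ≡ just v)
                          × (a₁ x ≡ just v ⊎ a₂ x ≡ just v → a x ≡ just v)

  _∖ₐ_ : Assign m → Assign m → Assign m
  (b ∖ₐ a) x with b x | a x
  ... | nothing | _ = nothing
  ... | just v  | nothing = just v
  ... | just v  | just w = if eqB v w then nothing else just v
    where
    eqB : Bool → Bool → Bool
    eqB true true = true
    eqB false false = true
    eqB _ _ = false

  _≗ₐ_ : Assign m → Assign m → Set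
  a ≗ₐ b = ∀ x → a x ≡ b x

  infixr 5 _⊗_
  _⊗_ : AssignSet m → AssignSet m → AssignSet m
  (H₁ ⊗ H₂) a = Σ (Assign m) λ a₁ → Σ (Assign m) λ a₂ → H₁ a₁ × H₂ a₂ × IsUnion a a₁ a₂

  Cube : VarSet m → AssignSet m
  Cube V a = Dom a V

  Single : Fin m → Bool → AssignSet m
  Single x b a = a ≗ₐ single x b

  _≐_ : AssignSet m → AssignSet m → Set
  H ≐ H' = ∀ c → (H c → H' c) × (H' c → H c)

  -- restriction H|_a, where V = Var(H)
  Restrict : VarSet m → AssignSet m → Assign m → AssignSet m
  Restrict V H a c = Σ (Assign m) λ b → H b × ProjSub a V b × (c ≗ₐ (b ∖ₐ a))

  flip : Fin m → Assign m → Assign m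
  flip x c y with x ≟ y
  ... | yes _ = Maybe.map not (c y)
  ... | no  _ = c y

  Inessential : VarSet m → AssignSet m → Fin m → Set
  Inessential V S x = V x × (∀ c → Dom c V → (S c → S (flip x c)) × (S (flip x c) → S c))

data Node (n m : ℕ) : Set where
  leaf : Bool → Node n m
  dec  : Fin m → Fin n → Fin n → Node n m   -- variable, 0-child, 1-child
  conj : Fin n → Fin n → Node n m

module Graph {n m : ℕ} (node : Fin n → Node n m) where

  data Step (u v : Fin n) : Set where
    decS  : (x : Fin m) (c₀ c₁ : Fin n) → node u ≡ dec x c₀ c₁ →
            (b : Bool) → v ≡ (if b then c₁ else c₀) → Step u v
    conjL : (c₀ c₁ : Fin n) → node u ≡ conj c₀ c₁ → v ≡ c₀ → Step u v
    conjR : (c₀ c₁ : Fin n) → node u ≡ conj c₀ c₁ → v ≡ c₁ → Step u v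

  Path : Fin n → Fin n → Set
  Path = Star Step

  IsVar : Fin n → Fin m → Set
  IsVar v x = Σ (Fin n) λ c₀ → Σ (Fin n) λ c₁ → node v ≡ dec x c₀ c₁

  VarB : Fin n → VarSet m
  VarB u x = Σ (Fin n) λ v → Path u v × IsVar v x

  data Sat (u : Fin n) (a : Assign m) : Set where
    sat-true : node u ≡ leaf true → a ≗ₐ ∅ₐ → Sat u a
    sat-dec0 : (x : Fin m) (c₀ c₁ : Fin n) → node u ≡ dec x c₀ c₁ →
               (Single x false ⊗ Sat c₀ ⊗ Cube (λ y → VarB c₁ y × ¬ VarB c₀ y)) a → Sat u a
    sat-dec1 : (x : Fin m) (c₀ c₁ : Fin n) → node u ≡ dec x c₀ c₁ →
               (Single x true ⊗ Sat c₁ ⊗ Cube (λ y → VarB c₀ y × ¬ VarB c₁ y)) a → Sat u a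
    sat-conj : (c₀ c₁ : Fin n) → node u ≡ conj c₀ c₁ →
               (Sat c₀ ⊗ Sat c₁) a → Sat u a

  PathVar : ∀ {u v} → Path u v → VarSet m
  PathVar ε y = ⊥
  PathVar (decS x _ _ _ _ _ ◅ p) y = x ≡ y ⊎ PathVar p y
  PathVar (conjL _ _ _ _ ◅ p) y = PathVar p y
  PathVar (conjR _ _ _ _ ◅ p) y = PathVar p y

  pathAssign : ∀ {u v} → Path u v → Assign m
  pathAssign ε = ∅ₐ
  pathAssign (decS x _ _ _ b _ ◅ p) y with x ≟ y
  ... | yes _ = just b
  ... | no  _ = pathAssign p y
  pathAssign (conjL _ _ _ _ ◅ p) = pathAssign p
  pathAssign (conjR _ _ _ _ ◅ p) = pathAssign p

  Alt : ∀ {u v} → Path u v → List (Fin n)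
  Alt ε = []
  Alt (decS _ _ _ _ _ _ ◅ p) = Alt p
  Alt (conjL c₀ c₁ _ _ ◅ p) = c₁ ∷ Alt p
  Alt (conjR c₀ c₁ _ _ ◅ p) = c₀ ∷ Alt p

  ProdSat : List (Fin n) → AssignSet m
  ProdSat [] = λ a → a ≗ₐ ∅ₐ
  ProdSat (v ∷ vs) = Sat v ⊗ ProdSat vs

record FBDD (n m : ℕ) : Set₁ where
  field
    node   : Fin n → Node n m
    source : Fin n
  open Graph node
  field
    acyclic      : ∀ {u v} → Step u v → Path v u → ⊥
    uniqueSource : ∀ v → ((∀ u → ¬ Step u v) → v ≡ source) × (v ≡ source → ∀ u → ¬ Step u v)
    sinks        : ∀ u v b → node u ≡ leaf b → node v ≡ leaf b → u ≡ v
    readOnce     : ∀ {u w v x} → IsVar u x → Step u w → Path w v → IsVar v x → ⊥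
    decomposable : ∀ {u c₀ c₁ x} → node u ≡ conj c₀ c₁ → VarB c₀ x → VarB c₁ x → ⊥

module _ {n m : ℕ} (B : FBDD n m) where
  open FBDD B
  open Graph node

  VarBDD : VarSet m
  VarBDD = VarB source

  SB : AssignSet m
  SB = Sat source

  V₀ : ∀ {v} → Path source v → VarSet m
  V₀ {v} P x = VarBDD x × ¬ VarB v x × (∀ w → w ∈ Alt P → ¬ VarB w x)

  -- f(B)|_a : variables Var(B) ∖ Var(a), satisfying set S(B)|_a
  VarRestr : Assign m → VarSet m
  VarRestr a x = VarBDD x × ¬ (Σ Bool λ b → a x ≡ just b)

  SRestr : Assign m → AssignSet m
  SRestr a = Restrict VarBDD SB a

-- Follow the target path from the source, keeping track of the restriction of
-- S(B_u) by a(P) for the current node u.  At a decision node on x with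
-- a(P)(x) = b, every extension takes the b-branch, so the restriction is that of
-- the b-child times the free cube on the variables occurring only below the other
-- child (read-onceness keeps x out of both children).  At a ∧-node,
-- decomposability splits each satisfying assignment between the two children and
-- a(P) only constrains the child on the path, so the alternative contributes the
-- whole of S(B_alt) as a factor.  At u(P) this leaves
-- S(B_u(P)) × ∏ S(B_alt) × {0,1}^V₀(P); a variable of V₀(P) occurs only in the
-- cube factor, so flipping it maps the restriction onto itself.

module Submission where

open import Defs
open import Level using (0ℓ) renaming (suc to lsuc)
open import Data.Nat using (ℕ)
open import Data.Bool using (Bool; true; false; not; if_then_else_)
open import Data.Bool.Properties using (not-involutive)
open import Data.Empty using (⊥; ⊥-elim)
open import Data.Fin using (Fin; _≟_)
open import Data.List using (List; []; _∷_)
open import Data.List.Membership.Propositional using (_∈_)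
open import Data.List.Relation.Unary.Any using (here; there)
open import Data.Maybe using (Maybe; just; nothing; maybe′)
import Data.Maybe as Maybe
open import Data.Maybe.Properties using (just-injective)
open import Data.Product using (Σ; _×_; _,_; proj₁; proj₂)
open import Data.Sum using (_⊎_; inj₁; inj₂; swap; [_,_])
open import Data.Sum as Sum using ()
open import Function using (_∘_)
open import Relation.Nullary using (¬_; Dec; yes; no)
open import Relation.Binary.Bundles using (Setoid)
open import Relation.Binary.PropositionalEquality using (_≡_; _≢_; refl; sym; trans; cong; subst)
open import Relation.Binary.Construct.Closure.ReflexiveTransitive using (ε; _◅_; _◅◅_)
import Relation.Binary.Reasoning.Setoid as SetoidReasoning

module Assignments {m : ℕ} where

  nothing≢just : ∀ {A : Set} {v : A} → nothing ≢ just v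
  nothing≢just ()

  just-ext : ∀ {A : Set} (p q : Maybe A) →
             (∀ v → p ≡ just v → q ≡ just v) → (∀ v → q ≡ just v → p ≡ just v) → p ≡ q
  just-ext (just v) q to from = sym (to v refl)
  just-ext nothing nothing to from = refl
  just-ext nothing (just w) to from = ⊥-elim (nothing≢just (from w refl))

  ≢just⇒nothing : ∀ {A : Set} (p : Maybe A) → (∀ v → p ≢ just v) → p ≡ nothing
  ≢just⇒nothing (just v) p≢ = ⊥-elim (p≢ v refl)
  ≢just⇒nothing nothing p≢ = refl

  Disjoint : Assign m → Assign m → Set
  Disjoint p q = ∀ x v → p x ≡ just v → q x ≡ nothing

  Compatible : Assign m → Assign m → Set
  Compatible p q = ∀ x v w → p x ≡ just v → q x ≡ just w → v ≡ w

  Extensional : AssignSet m → Set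
  Extensional H = ∀ {a a'} → a ≗ₐ a' → H a → H a'

  IsUnion-sym : ∀ {a p q : Assign m} → IsUnion a p q → IsUnion a q p
  IsUnion-sym u x v = swap ∘ proj₁ (u x v) , proj₂ (u x v) ∘ swap

  IsUnion-resp : ∀ {a p q a' p' q' : Assign m} →
                 a ≗ₐ a' → p ≗ₐ p' → q ≗ₐ q' → IsUnion a p q → IsUnion a' p' q'
  IsUnion-resp a≗ p≗ q≗ u x v rewrite sym (a≗ x) | sym (p≗ x) | sym (q≗ x) = u x v

  IsUnion-unique : ∀ {a a' p q : Assign m} → IsUnion a p q → IsUnion a' p q → a ≗ₐ a'
  IsUnion-unique u u' x =
    just-ext _ _ (λ v → proj₂ (u' x v) ∘ proj₁ (u x v)) (λ v → proj₂ (u x v) ∘ proj₁ (u' x v))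

  IsUnion-⊆ˡ : ∀ {a p q : Assign m} → IsUnion a p q → p ⊆ₐ a
  IsUnion-⊆ˡ u x v = proj₂ (u x v) ∘ inj₁

  IsUnion-⊆ʳ : ∀ {a p q : Assign m} → IsUnion a p q → q ⊆ₐ a
  IsUnion-⊆ʳ u x v = proj₂ (u x v) ∘ inj₂

  IsUnion-identityˡ : ∀ {q : Assign m} → IsUnion q ∅ₐ q
  IsUnion-identityˡ y v = inj₂ , λ { (inj₁ ()) ; (inj₂ e) → e }

  IsUnion-∅ˡ : ∀ {a z q : Assign m} → z ≗ₐ ∅ₐ → IsUnion a z q → a ≗ₐ q
  IsUnion-∅ˡ z≗∅ u = IsUnion-unique (IsUnion-resp (λ _ → refl) z≗∅ (λ _ → refl) u) IsUnion-identityˡ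

  IsUnion-assoc : ∀ {a ab bc a₁ a₂ a₃ : Assign m} →
                  IsUnion a ab a₃ → IsUnion ab a₁ a₂ → IsUnion bc a₂ a₃ → IsUnion a a₁ bc
  IsUnion-assoc {a} {ab} {bc} {a₁} {a₂} {a₃} u u₁₂ u₂₃ x v = to , from
    where
    to : a x ≡ just v → a₁ x ≡ just v ⊎ bc x ≡ just v
    to e with proj₁ (u x v) e
    ... | inj₂ e₃ = inj₂ (IsUnion-⊆ʳ u₂₃ x v e₃)
    ... | inj₁ e₁₂ with proj₁ (u₁₂ x v) e₁₂
    ...   | inj₁ e₁ = inj₁ e₁
    ...   | inj₂ e₂ = inj₂ (IsUnion-⊆ˡ u₂₃ x v e₂)
    from : a₁ x ≡ just v ⊎ bc x ≡ just v → a x ≡ just v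
    from (inj₁ e₁) = IsUnion-⊆ˡ u x v (IsUnion-⊆ˡ u₁₂ x v e₁)
    from (inj₂ e₂₃) with proj₁ (u₂₃ x v) e₂₃
    ... | inj₁ e₂ = IsUnion-⊆ˡ u x v (IsUnion-⊆ʳ u₁₂ x v e₂)
    ... | inj₂ e₃ = IsUnion-⊆ʳ u x v e₃

  -- Biased towards the left operand; it is a union only for compatible operands.
  _∪ₐ_ : Assign m → Assign m → Assign m
  (p ∪ₐ q) x = maybe′ just (q x) (p x)

  ∪ₐ-isUnion : ∀ {p q : Assign m} → Compatible p q → IsUnion (p ∪ₐ q) p q
  ∪ₐ-isUnion {p} {q} c x v with p x | c x
  ... | just w  | cx = inj₁ , λ { (inj₁ e) → e ; (inj₂ e) → cong just (cx w v refl e) }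
  ... | nothing | _  = inj₂ , λ { (inj₁ ()) ; (inj₂ e) → e }

  ⊆-compatible : ∀ {a p q : Assign m} → p ⊆ₐ a → q ⊆ₐ a → Compatible p q
  ⊆-compatible p⊆a q⊆a x v w e₁ e₂ = just-injective (trans (sym (p⊆a x v e₁)) (q⊆a x w e₂))

  disjoint-compatible : ∀ {p q : Assign m} → Disjoint p q → Compatible p q
  disjoint-compatible d x v w e₁ e₂ = ⊥-elim (nothing≢just (trans (sym (d x v e₁)) e₂))

  ≐-refl : ∀ {H : AssignSet m} → H ≐ H
  ≐-refl c = (λ h → h) , (λ h → h)

  ≐-sym : ∀ {H H' : AssignSet m} → H ≐ H' → H' ≐ H
  ≐-sym e c = proj₂ (e c) , proj₁ (e c)

  ≐-trans : ∀ {H H' H'' : AssignSet m} → H ≐ H' → H' ≐ H'' → H ≐ H''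
  ≐-trans e e' c = proj₁ (e' c) ∘ proj₁ (e c) , proj₂ (e c) ∘ proj₂ (e' c)

  ≐-setoid : Setoid (lsuc 0ℓ) 0ℓ
  ≐-setoid = record
    { Carrier = AssignSet m
    ; _≈_ = _≐_
    ; isEquivalence = record { refl = ≐-refl ; sym = ≐-sym ; trans = ≐-trans }
    }

  module ≐-Reasoning = SetoidReasoning ≐-setoid

  ⊗-cong : ∀ {A A' C C' : AssignSet m} → A ≐ A' → C ≐ C' → (A ⊗ C) ≐ (A' ⊗ C')
  ⊗-cong e f c = (λ (a₁ , a₂ , h₁ , h₂ , u) → a₁ , a₂ , proj₁ (e a₁) h₁ , proj₁ (f a₂) h₂ , u)
               , (λ (a₁ , a₂ , h₁ , h₂ , u) → a₁ , a₂ , proj₂ (e a₁) h₁ , proj₂ (f a₂) h₂ , u)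

  ⊗-congˡ : ∀ {A C C' : AssignSet m} → C ≐ C' → (A ⊗ C) ≐ (A ⊗ C')
  ⊗-congˡ = ⊗-cong ≐-refl

  ⊗-congʳ : ∀ {A A' C : AssignSet m} → A ≐ A' → (A ⊗ C) ≐ (A' ⊗ C)
  ⊗-congʳ e = ⊗-cong e ≐-refl

  ⊗-comm : ∀ {A C : AssignSet m} → (A ⊗ C) ≐ (C ⊗ A)
  ⊗-comm c = (λ (a₁ , a₂ , h₁ , h₂ , u) → a₂ , a₁ , h₂ , h₁ , IsUnion-sym u)
           , (λ (a₁ , a₂ , h₁ , h₂ , u) → a₂ , a₁ , h₂ , h₁ , IsUnion-sym u)

  ⊗-assoc : ∀ {A C D : AssignSet m} → ((A ⊗ C) ⊗ D) ≐ (A ⊗ (C ⊗ D))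
  ⊗-assoc c = to , from
    where
    to : _
    to (_ , a₃ , (a₁ , a₂ , h₁ , h₂ , u₁₂) , h₃ , u) =
      a₁ , a₂ ∪ₐ a₃ , h₁ , (a₂ , a₃ , h₂ , h₃ , u₂₃) , IsUnion-assoc u u₁₂ u₂₃
      where
      u₂₃ = ∪ₐ-isUnion (⊆-compatible (λ x v → IsUnion-⊆ˡ u x v ∘ IsUnion-⊆ʳ u₁₂ x v) (IsUnion-⊆ʳ u))
    from : _
    from (a₁ , _ , h₁ , (a₂ , a₃ , h₂ , h₃ , u₂₃) , u) =
      a₁ ∪ₐ a₂ , a₃ , (a₁ , a₂ , h₁ , h₂ , u₁₂) , h₃ ,
      IsUnion-sym (IsUnion-assoc (IsUnion-sym u) (IsUnion-sym u₂₃) (IsUnion-sym u₁₂))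
      where
      u₁₂ = ∪ₐ-isUnion (⊆-compatible (IsUnion-⊆ˡ u) (λ x v → IsUnion-⊆ʳ u x v ∘ IsUnion-⊆ˡ u₂₃ x v))

  ⊗-rotate : ∀ {A C D E : AssignSet m} → ((A ⊗ C ⊗ D) ⊗ E) ≐ (A ⊗ (E ⊗ C) ⊗ D)
  ⊗-rotate {A} {C} {D} {E} = begin
      (A ⊗ C ⊗ D) ⊗ E    ≈⟨ ⊗-assoc ⟩
      A ⊗ (C ⊗ D) ⊗ E    ≈⟨ ⊗-congˡ ⊗-assoc ⟩
      A ⊗ C ⊗ D ⊗ E      ≈⟨ ⊗-congˡ (⊗-congˡ ⊗-comm) ⟩
      A ⊗ C ⊗ E ⊗ D      ≈⟨ ⊗-congˡ (≐-sym ⊗-assoc) ⟩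
      A ⊗ (C ⊗ E) ⊗ D    ≈⟨ ⊗-congˡ (⊗-congʳ ⊗-comm) ⟩
      A ⊗ (E ⊗ C) ⊗ D    ∎
    where open ≐-Reasoning

  Unit : AssignSet m
  Unit a = a ≗ₐ ∅ₐ

  ⊗-identityˡ : ∀ {H : AssignSet m} → Extensional H → (Unit ⊗ H) ≐ H
  ⊗-identityˡ ext c = (λ (z , q , z≗∅ , hq , u) → ext (λ y → sym (IsUnion-∅ˡ z≗∅ u y)) hq)
                    , (λ h → ∅ₐ , c , (λ _ → refl) , h , IsUnion-identityˡ)

  ⊗-identityʳ : ∀ {H : AssignSet m} → Extensional H → (H ⊗ Unit) ≐ H
  ⊗-identityʳ ext = ≐-trans ⊗-comm (⊗-identityˡ ext)

  Unit-ext : Extensional Unit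
  Unit-ext a≗a' a≗∅ y = trans (sym (a≗a' y)) (a≗∅ y)

  ∖ₐ-just⁻ : ∀ (b a : Assign m) x v → (b ∖ₐ a) x ≡ just v → b x ≡ just v × a x ≢ just v
  ∖ₐ-just⁻ b a x v e with b x | a x
  ∖ₐ-just⁻ b a x v ()   | nothing    | _
  ∖ₐ-just⁻ b a x v e    | just w     | nothing    = e , λ ()
  ∖ₐ-just⁻ b a x v ()   | just true  | just true
  ∖ₐ-just⁻ b a x v ()   | just false | just false
  ∖ₐ-just⁻ b a x _ refl | just true  | just false = refl , λ ()
  ∖ₐ-just⁻ b a x _ refl | just false | just true  = refl , λ ()

  ∖ₐ-just⁺ : ∀ (b a : Assign m) x v → b x ≡ just v → a x ≢ just v → (b ∖ₐ a) x ≡ just v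
  ∖ₐ-just⁺ b a x v e a≢ with b x | a x
  ∖ₐ-just⁺ b a x v ()   a≢ | nothing    | _
  ∖ₐ-just⁺ b a x v e    a≢ | just w     | nothing    = e
  ∖ₐ-just⁺ b a x _ refl a≢ | just true  | just true  = ⊥-elim (a≢ refl)
  ∖ₐ-just⁺ b a x _ refl a≢ | just false | just false = ⊥-elim (a≢ refl)
  ∖ₐ-just⁺ b a x _ refl a≢ | just true  | just false = refl
  ∖ₐ-just⁺ b a x _ refl a≢ | just false | just true  = refl

  ∖ₐ-isUnion : ∀ {b p q : Assign m} (a : Assign m) → IsUnion b p q → IsUnion (b ∖ₐ a) (p ∖ₐ a) (q ∖ₐ a)
  ∖ₐ-isUnion {b} {p} {q} a u x v = to , from
    where
    to : (b ∖ₐ a) x ≡ just v → (p ∖ₐ a) x ≡ just v ⊎ (q ∖ₐ a) x ≡ just v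
    to e with ∖ₐ-just⁻ b a x v e
    ... | eb , a≢ with proj₁ (u x v) eb
    ...   | inj₁ ep = inj₁ (∖ₐ-just⁺ p a x v ep a≢)
    ...   | inj₂ eq = inj₂ (∖ₐ-just⁺ q a x v eq a≢)
    from : (p ∖ₐ a) x ≡ just v ⊎ (q ∖ₐ a) x ≡ just v → (b ∖ₐ a) x ≡ just v
    from (inj₁ e) with ∖ₐ-just⁻ p a x v e
    ... | ep , a≢ = ∖ₐ-just⁺ b a x v (IsUnion-⊆ˡ u x v ep) a≢
    from (inj₂ e) with ∖ₐ-just⁻ q a x v e
    ... | eq , a≢ = ∖ₐ-just⁺ b a x v (IsUnion-⊆ʳ u x v eq) a≢

  ∖ₐ-disjoint : ∀ {q a : Assign m} → Disjoint a q → (q ∖ₐ a) ≗ₐ q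
  ∖ₐ-disjoint {q} {a} d y = just-ext _ _ (λ v → proj₁ ∘ ∖ₐ-just⁻ q a y v)
    (λ v e → ∖ₐ-just⁺ q a y v e (λ ea → nothing≢just (trans (sym (d y v ea)) e)))

  ∖ₐ-⊆ : ∀ {p a : Assign m} → p ⊆ₐ a → (p ∖ₐ a) ≗ₐ ∅ₐ
  ∖ₐ-⊆ {p} {a} p⊆a y = ≢just⇒nothing _ λ v e → let (ep , a≢) = ∖ₐ-just⁻ p a y v e in a≢ (p⊆a y v ep)

  ∖ₐ-∅ : ∀ (b : Assign m) → (b ∖ₐ ∅ₐ) ≗ₐ b
  ∖ₐ-∅ b = ∖ₐ-disjoint (λ y v ())

  ∖ₐ-cong : ∀ (b : Assign m) {a a' : Assign m} → (∀ y → (Σ Bool λ v → b y ≡ just v) → a y ≡ a' y) →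
            (b ∖ₐ a) ≗ₐ (b ∖ₐ a')
  ∖ₐ-cong b {a} {a'} agree y = just-ext _ _
    (λ v e → let (eb , a≢) = ∖ₐ-just⁻ b a y v e in
             ∖ₐ-just⁺ b a' y v eb (λ ea' → a≢ (trans (agree y (v , eb)) ea')))
    (λ v e → let (eb , a≢) = ∖ₐ-just⁻ b a' y v e in
             ∖ₐ-just⁺ b a y v eb (λ ea → a≢ (trans (sym (agree y (v , eb))) ea)))

  Dom-resp : ∀ {a a' : Assign m} {V : VarSet m} → a ≗ₐ a' → Dom a V → Dom a' V
  Dom-resp a≗ d x rewrite sym (a≗ x) = d x

  Dom-⇔ : ∀ {a : Assign m} {V V' : VarSet m} → (∀ x → V x → V' x) → (∀ x → V' x → V x) → Dom a V → Dom a V'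
  Dom-⇔ to from d x = to x ∘ proj₁ (d x) , proj₂ (d x) ∘ from x

  Dom-isUnion : ∀ {a p q : Assign m} {V₁ V₂ : VarSet m} →
                IsUnion a p q → Dom p V₁ → Dom q V₂ → Dom a (λ x → V₁ x ⊎ V₂ x)
  Dom-isUnion u d₁ d₂ x = to , from
    where
    to : _
    to (b , e) with proj₁ (u x b) e
    ... | inj₁ e₁ = inj₁ (proj₁ (d₁ x) (b , e₁))
    ... | inj₂ e₂ = inj₂ (proj₁ (d₂ x) (b , e₂))
    from : _
    from (inj₁ v₁) = let (b , e) = proj₂ (d₁ x) v₁ in b , IsUnion-⊆ˡ u x b e
    from (inj₂ v₂) = let (b , e) = proj₂ (d₂ x) v₂ in b , IsUnion-⊆ʳ u x b e

  Dom-single : ∀ (x : Fin m) b → Dom (single x b) (x ≡_)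
  Dom-single x b y with x ≟ y
  ... | yes x≡y = (λ _ → x≡y) , (λ _ → b , refl)
  ... | no  x≢y = (λ { (_ , ()) }) , (⊥-elim ∘ x≢y)

  Dom-∉ : ∀ {a : Assign m} {V : VarSet m} → Dom a V → ∀ y → ¬ V y → a y ≡ nothing
  Dom-∉ d y ¬Vy = ≢just⇒nothing _ (λ v e → ¬Vy (proj₁ (d y) (v , e)))

  Dom-∅ : ∀ {V : VarSet m} → (∀ y → ¬ V y) → Dom ∅ₐ V
  Dom-∅ ¬V y = (λ { (_ , ()) }) , (⊥-elim ∘ ¬V y)

  Dom-dec : ∀ {a : Assign m} {V : VarSet m} → Dom a V → ∀ x → Dec (V x)
  Dom-dec {a} d x with a x | proj₁ (d x) | proj₂ (d x)
  ... | just v  | to | _    = yes (to (v , refl))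
  ... | nothing | _  | from = no λ Vx → nothing≢just (proj₂ (from Vx))

  Cube-ext : ∀ {V : VarSet m} → Extensional (Cube V)
  Cube-ext = Dom-resp

  Cube-⇔ : ∀ {V V' : VarSet m} → (∀ y → V y → V' y) → (∀ y → V' y → V y) → Cube V ≐ Cube V'
  Cube-⇔ to from r = Dom-⇔ to from , Dom-⇔ from to

  Cube-∅ : ∀ {V : VarSet m} → (∀ y → ¬ V y) → Cube V ≐ Unit
  Cube-∅ ¬V r = (λ d y → Dom-∉ d y (¬V y)) , (λ r≗∅ → Dom-resp (λ y → sym (r≗∅ y)) (Dom-∅ ¬V))

  module _ {Q : VarSet m} (Q? : ∀ y → Dec (Q y)) where

    inside outside : Assign m → Assign m
    inside r y with Q? y
    ... | yes _ = r y
    ... | no  _ = nothing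
    outside r y with Q? y
    ... | yes _ = nothing
    ... | no  _ = r y

    inside-outside-isUnion : ∀ r → IsUnion r (inside r) (outside r)
    inside-outside-isUnion r y v with Q? y
    ... | yes _ = inj₁ , λ { (inj₁ e) → e ; (inj₂ ()) }
    ... | no  _ = inj₂ , λ { (inj₁ ()) ; (inj₂ e) → e }

    Dom-inside : ∀ {r : Assign m} {W : VarSet m} → Dom r W → Dom (inside r) (λ y → W y × Q y)
    Dom-inside d y with Q? y
    ... | yes Qy = (λ e → proj₁ (d y) e , Qy) , proj₂ (d y) ∘ proj₁
    ... | no ¬Qy = (λ { (_ , ()) }) , (λ (_ , Qy) → ⊥-elim (¬Qy Qy))

    Dom-outside : ∀ {r : Assign m} {W : VarSet m} → Dom r W → Dom (outside r) (λ y → W y × ¬ Q y)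
    Dom-outside d y with Q? y
    ... | yes Qy = (λ { (_ , ()) }) , (λ (_ , ¬Qy) → ⊥-elim (¬Qy Qy))
    ... | no ¬Qy = (λ e → proj₁ (d y) e , ¬Qy) , proj₂ (d y) ∘ proj₁

    Cube-split : ∀ {W : VarSet m} → Cube W ≐ (Cube (λ y → W y × Q y) ⊗ Cube (λ y → W y × ¬ Q y))
    Cube-split r = (λ d → inside r , outside r , Dom-inside d , Dom-outside d , inside-outside-isUnion r)
                 , (λ (r₁ , r₂ , d₁ , d₂ , u) → Dom-⇔ merge separate (Dom-isUnion u d₁ d₂))
      where
      merge : ∀ {W : VarSet m} y → (W y × Q y) ⊎ (W y × ¬ Q y) → W y
      merge y (inj₁ (w , _)) = w
      merge y (inj₂ (w , _)) = w
      separate : ∀ {W : VarSet m} y → W y → (W y × Q y) ⊎ (W y × ¬ Q y)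
      separate y w with Q? y
      ... | yes Qy = inj₁ (w , Qy)
      ... | no ¬Qy = inj₂ (w , ¬Qy)

  flip-at : ∀ (c : Assign m) x → flip x c x ≡ Maybe.map not (c x)
  flip-at c x with x ≟ x
  ... | yes _ = refl
  ... | no x≢x = ⊥-elim (x≢x refl)

  flip-off : ∀ (c : Assign m) {x y} → x ≢ y → flip x c y ≡ c y
  flip-off c {x} {y} x≢y with x ≟ y
  ... | yes x≡y = ⊥-elim (x≢y x≡y)
  ... | no _ = refl

  map-not-involutive : ∀ (p : Maybe Bool) → Maybe.map not (Maybe.map not p) ≡ p
  map-not-involutive nothing = refl
  map-not-involutive (just v) = cong just (not-involutive v)

  flip-involutive : ∀ (c : Assign m) x → flip x (flip x c) ≗ₐ c
  flip-involutive c x y = by-cases (x ≟ y)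
    where
    by-cases : Dec (x ≡ y) → flip x (flip x c) y ≡ c y
    by-cases (yes refl) = trans (flip-at (flip x c) x)
                                (trans (cong (Maybe.map not) (flip-at c x)) (map-not-involutive (c x)))
    by-cases (no x≢y) = trans (flip-off (flip x c) x≢y) (flip-off c x≢y)

  flip-Dom : ∀ {c : Assign m} {V : VarSet m} x → Dom c V → Dom (flip x c) V
  flip-Dom {c} x d y with x ≟ y
  ... | no _ = d y
  ... | yes refl with c x | proj₁ (d x) | proj₂ (d x)
  ...   | just v  | to | from = (λ _ → to (v , refl)) , (λ _ → not v , refl)
  ...   | nothing | to | from = (λ { (_ , ()) }) , (λ Vx → ⊥-elim (nothing≢just (proj₂ (from Vx))))

  IsUnion-outsideˡ : ∀ {c p q : Assign m} x → p x ≡ nothing → IsUnion c p q → c x ≡ q x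
  IsUnion-outsideˡ x px≡nothing u = just-ext _ _ from-c (λ v → IsUnion-⊆ʳ u x v)
    where
    from-c : ∀ v → _ → _
    from-c v e with proj₁ (u x v) e
    ... | inj₁ e₁ = ⊥-elim (nothing≢just (trans (sym px≡nothing) e₁))
    ... | inj₂ e₂ = e₂

  flip-isUnionʳ : ∀ {c p q : Assign m} x → p x ≡ nothing → IsUnion c p q → IsUnion (flip x c) p (flip x q)
  flip-isUnionʳ {c} {p} {q} x px≡nothing u y v with x ≟ y
  ... | no _ = u y v
  ... | yes refl rewrite px≡nothing | IsUnion-outsideˡ x px≡nothing u = inj₂ , λ { (inj₁ ()) ; (inj₂ e) → e }

  flip-⊗ʳ : ∀ {A C : AssignSet m} x → (∀ a → A a → a x ≡ nothing) → (∀ b → C b → C (flip x b)) →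
            ∀ c → (A ⊗ C) c → (A ⊗ C) (flip x c)
  flip-⊗ʳ x A∌x C-flip c (a , b , ha , hb , u) = a , flip x b , ha , C-flip b hb , flip-isUnionʳ x (A∌x a ha) u

  flip-closed⇒inessential : ∀ {V : VarSet m} {S : AssignSet m} {x} →
    Extensional S → (∀ c → S c → S (flip x c)) → V x → Inessential V S x
  flip-closed⇒inessential {x = x} ext closed Vx =
    Vx , λ c _ → closed c , λ h → ext (flip-involutive c x) (closed (flip x c) h)

module Diagram {n m : ℕ} (B : FBDD n m) where
  open FBDD B
  open Graph node
  open Assignments {m}

  VarDiff : Fin n → Fin n → VarSet m
  VarDiff o w y = VarB o y × ¬ VarB w y

  VarB-step : ∀ {u w y} → Step u w → VarB w y → VarB u y
  VarB-step s (v , p , x∈v) = v , s ◅ p , x∈v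

  VarB-path : ∀ {u w y} → Path u w → VarB w y → VarB u y
  VarB-path q (v , p , x∈v) = v , q ◅◅ p , x∈v

  VarB-here : ∀ {u x c₀ c₁} → node u ≡ dec x c₀ c₁ → VarB u x
  VarB-here eq = _ , ε , _ , _ , eq

  VarB-dec : ∀ {u x c₀ c₁ y} → node u ≡ dec x c₀ c₁ → VarB u y → x ≡ y ⊎ VarB c₀ y ⊎ VarB c₁ y
  VarB-dec eq (v , ε , _ , _ , eq') with trans (sym eq) eq'
  ... | refl = inj₁ refl
  VarB-dec eq (v , decS _ _ _ eq' false refl ◅ p , y∈v) with trans (sym eq) eq'
  ... | refl = inj₂ (inj₁ (v , p , y∈v))
  VarB-dec eq (v , decS _ _ _ eq' true refl ◅ p , y∈v) with trans (sym eq) eq'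
  ... | refl = inj₂ (inj₂ (v , p , y∈v))
  VarB-dec eq (v , conjL _ _ eq' _ ◅ p , y∈v) with trans (sym eq) eq'
  ... | ()
  VarB-dec eq (v , conjR _ _ eq' _ ◅ p , y∈v) with trans (sym eq) eq'
  ... | ()

  VarB-conj : ∀ {u c₀ c₁ y} → node u ≡ conj c₀ c₁ → VarB u y → VarB c₀ y ⊎ VarB c₁ y
  VarB-conj eq (v , ε , _ , _ , eq') with trans (sym eq) eq'
  ... | ()
  VarB-conj eq (v , decS _ _ _ eq' _ _ ◅ p , y∈v) with trans (sym eq) eq'
  ... | ()
  VarB-conj eq (v , conjL _ _ eq' refl ◅ p , y∈v) with trans (sym eq) eq'
  ... | refl = inj₁ (v , p , y∈v)
  VarB-conj eq (v , conjR _ _ eq' refl ◅ p , y∈v) with trans (sym eq) eq'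
  ... | refl = inj₂ (v , p , y∈v)

  leaf-no-step : ∀ {u w b} → node u ≡ leaf b → ¬ Step u w
  leaf-no-step eq (decS _ _ _ eq' _ _) with trans (sym eq) eq'
  ... | ()
  leaf-no-step eq (conjL _ _ eq' _) with trans (sym eq) eq'
  ... | ()
  leaf-no-step eq (conjR _ _ eq' _) with trans (sym eq) eq'
  ... | ()

  VarB-leaf : ∀ {u b y} → node u ≡ leaf b → ¬ VarB u y
  VarB-leaf eq (_ , ε , _ , _ , eq') with trans (sym eq) eq'
  ... | ()
  VarB-leaf eq (_ , s ◅ _ , _) = leaf-no-step eq s

  tested-not-below : ∀ {u w x c₀ c₁} → node u ≡ dec x c₀ c₁ → Step u w → ¬ VarB w x
  tested-not-below eq s (_ , p , x∈v) = readOnce (_ , _ , eq) s p x∈v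

  -- In Junction and Decision, w is the child taken by the path and o the other one.
  record Junction (u w o : Fin n) : Set where
    field
      sat⇒     : ∀ {e} → Sat u e → (Sat w ⊗ Sat o) e
      sat⇐     : ∀ {e} → (Sat w ⊗ Sat o) e → Sat u e
      vars     : ∀ {y} → VarB u y → VarB w y ⊎ VarB o y
      step     : Step u w
      alt-step : Step u o
      disjoint : ∀ {y} → VarB w y → ¬ VarB o y

  conj-sat : ∀ {u c₀ c₁ e} → node u ≡ conj c₀ c₁ → Sat u e → (Sat c₀ ⊗ Sat c₁) e
  conj-sat eq (sat-true eq' _) with trans (sym eq) eq'
  ... | ()
  conj-sat eq (sat-dec0 _ _ _ eq' _) with trans (sym eq) eq'
  ... | ()
  conj-sat eq (sat-dec1 _ _ _ eq' _) with trans (sym eq) eq'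
  ... | ()
  conj-sat eq (sat-conj _ _ eq' h) with trans (sym eq) eq'
  ... | refl = h

  junctionˡ : ∀ {u c₀ c₁} → node u ≡ conj c₀ c₁ → Junction u c₀ c₁
  junctionˡ {c₀ = c₀} {c₁} eq = record
    { sat⇒     = conj-sat eq
    ; sat⇐     = sat-conj c₀ c₁ eq
    ; vars     = VarB-conj eq
    ; step     = conjL c₀ c₁ eq refl
    ; alt-step = conjR c₀ c₁ eq refl
    ; disjoint = decomposable eq
    }

  junctionʳ : ∀ {u c₀ c₁} → node u ≡ conj c₀ c₁ → Junction u c₁ c₀
  junctionʳ {c₀ = c₀} {c₁} eq = record
    { sat⇒     = λ h → proj₁ (⊗-comm _) (conj-sat eq h)
    ; sat⇐     = λ h → sat-conj c₀ c₁ eq (proj₁ (⊗-comm _) h)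
    ; vars     = swap ∘ VarB-conj eq
    ; step     = conjR c₀ c₁ eq refl
    ; alt-step = conjL c₀ c₁ eq refl
    ; disjoint = λ y∈c₁ y∈c₀ → decomposable eq y∈c₀ y∈c₁
    }

  record Decision (u w o : Fin n) (x : Fin m) (b : Bool) : Set where
    field
      sat⇒     : ∀ {e} → Sat u e → e x ≡ just b → (Single x b ⊗ Sat w ⊗ Cube (VarDiff o w)) e
      sat⇐     : ∀ {e} → (Single x b ⊗ Sat w ⊗ Cube (VarDiff o w)) e → Sat u e
      vars     : ∀ {y} → VarB u y → x ≡ y ⊎ VarB w y ⊎ VarB o y
      tested   : VarB u x
      step     : Step u w
      alt-step : Step u o
      ∉w       : ¬ VarB w x
      ∉o       : ¬ VarB o x

  single-at : ∀ (x : Fin m) b → single x b x ≡ just b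
  single-at x b with x ≟ x
  ... | yes _ = refl
  ... | no x≢x = ⊥-elim (x≢x refl)

  single-just : ∀ {x : Fin m} {b y v} → single x b y ≡ just v → x ≡ y × b ≡ v
  single-just {x} {b} {y} e with x ≟ y
  single-just refl | yes x≡y = x≡y , refl

  Single-value : ∀ {x b e} {C : AssignSet m} → (Single x b ⊗ C) e → e x ≡ just b
  Single-value {x} {b} (sg , _ , sg≗ , _ , u) = IsUnion-⊆ˡ u x b (trans (sg≗ x) (single-at x b))

  just-not : ∀ {b} {p : Maybe Bool} → p ≡ just b → p ≢ just (not b)
  just-not {false} refl ()
  just-not {true} refl ()

  dec-sat0 : ∀ {u x c₀ c₁ e} → node u ≡ dec x c₀ c₁ → Sat u e → e x ≡ just false →
             (Single x false ⊗ Sat c₀ ⊗ Cube (VarDiff c₁ c₀)) e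
  dec-sat0 eq (sat-true eq' _) _ with trans (sym eq) eq'
  ... | ()
  dec-sat0 eq (sat-conj _ _ eq' _) _ with trans (sym eq) eq'
  ... | ()
  dec-sat0 eq (sat-dec0 _ _ _ eq' h) _ with trans (sym eq) eq'
  ... | refl = h
  dec-sat0 eq (sat-dec1 _ _ _ eq' h) ex with trans (sym eq) eq'
  ... | refl = ⊥-elim (just-not ex (Single-value h))

  dec-sat1 : ∀ {u x c₀ c₁ e} → node u ≡ dec x c₀ c₁ → Sat u e → e x ≡ just true →
             (Single x true ⊗ Sat c₁ ⊗ Cube (VarDiff c₀ c₁)) e
  dec-sat1 eq (sat-true eq' _) _ with trans (sym eq) eq'
  ... | ()
  dec-sat1 eq (sat-conj _ _ eq' _) _ with trans (sym eq) eq'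
  ... | ()
  dec-sat1 eq (sat-dec1 _ _ _ eq' h) _ with trans (sym eq) eq'
  ... | refl = h
  dec-sat1 eq (sat-dec0 _ _ _ eq' h) ex with trans (sym eq) eq'
  ... | refl = ⊥-elim (just-not ex (Single-value h))

  decision : ∀ {u x c₀ c₁} → node u ≡ dec x c₀ c₁ → (b : Bool) →
             Decision u (if b then c₁ else c₀) (if b then c₀ else c₁) x b
  decision {x = x} {c₀} {c₁} eq false = record
    { sat⇒     = dec-sat0 eq
    ; sat⇐     = sat-dec0 x c₀ c₁ eq
    ; vars     = VarB-dec eq
    ; tested   = VarB-here eq
    ; step     = decS x c₀ c₁ eq false refl
    ; alt-step = decS x c₀ c₁ eq true refl
    ; ∉w       = tested-not-below eq (decS x c₀ c₁ eq false refl)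
    ; ∉o       = tested-not-below eq (decS x c₀ c₁ eq true refl)
    }
  decision {x = x} {c₀} {c₁} eq true = record
    { sat⇒     = dec-sat1 eq
    ; sat⇐     = sat-dec1 x c₀ c₁ eq
    ; vars     = Sum.map₂ swap ∘ VarB-dec eq
    ; tested   = VarB-here eq
    ; step     = decS x c₀ c₁ eq true refl
    ; alt-step = decS x c₀ c₁ eq false refl
    ; ∉w       = tested-not-below eq (decS x c₀ c₁ eq true refl)
    ; ∉o       = tested-not-below eq (decS x c₀ c₁ eq false refl)
    }

  Cube-junction : ∀ {u w o} {e : Assign m} → Junction u w o →
                  (Cube (VarB w) ⊗ Cube (VarB o)) e → Cube (VarB u) e
  Cube-junction J (_ , _ , d₀ , d₁ , u) =
    Dom-⇔ (λ _ → [ VarB-step step , VarB-step alt-step ]) (λ _ → vars) (Dom-isUnion u d₀ d₁)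
    where open Junction J

  Cube-decision : ∀ {u w o x b} {e : Assign m} → Decision u w o x b →
                  (Single x b ⊗ Cube (VarB w) ⊗ Cube (VarDiff o w)) e → Cube (VarB u) e
  Cube-decision {x = x} {b} D (sg , _ , sg≗ , (_ , _ , ds , dk , u₂) , u₁) =
    Dom-⇔ to from (Dom-isUnion u₁ (Dom-resp (sym ∘ sg≗) (Dom-single x b)) (Dom-isUnion u₂ ds dk))
    where
    open Decision D
    to : ∀ y → _ → _
    to y (inj₁ refl) = tested
    to y (inj₂ (inj₁ y∈w)) = VarB-step step y∈w
    to y (inj₂ (inj₂ (y∈o , _))) = VarB-step alt-step y∈o
    from : ∀ y → _ → _
    from y y∈u with vars y∈u
    ... | inj₁ x≡y = inj₁ x≡y
    ... | inj₂ (inj₁ y∈w) = inj₂ (inj₁ y∈w)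
    ... | inj₂ (inj₂ y∈o) with Dom-dec ds y
    ...   | yes y∈w = inj₂ (inj₁ y∈w)
    ...   | no y∉w = inj₂ (inj₂ (y∈o , y∉w))

  Sat-dom : ∀ {u e} → Sat u e → Cube (VarB u) e
  Sat-dom (sat-true eq e≗∅) = Dom-resp (sym ∘ e≗∅) (Dom-∅ λ _ → VarB-leaf eq)
  Sat-dom (sat-dec0 _ _ _ eq (sg , sk , sg≗ , (s , k , hs , hk , u₂) , u₁)) =
    Cube-decision (decision eq false) (sg , sk , sg≗ , (s , k , Sat-dom hs , hk , u₂) , u₁)
  Sat-dom (sat-dec1 _ _ _ eq (sg , sk , sg≗ , (s , k , hs , hk , u₂) , u₁)) =
    Cube-decision (decision eq true) (sg , sk , sg≗ , (s , k , Sat-dom hs , hk , u₂) , u₁)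
  Sat-dom (sat-conj _ _ eq (s₀ , s₁ , h₀ , h₁ , u)) =
    Cube-junction (junctionˡ eq) (s₀ , s₁ , Sat-dom h₀ , Sat-dom h₁ , u)

  ⊗-ext : ∀ {A C : AssignSet m} → Extensional (A ⊗ C)
  ⊗-ext e≗ (a₁ , a₂ , h₁ , h₂ , u) = a₁ , a₂ , h₁ , h₂ , IsUnion-resp e≗ (λ _ → refl) (λ _ → refl) u

  Sat-ext : ∀ {u} → Extensional (Sat u)
  Sat-ext e≗ (sat-true eq e≗∅) = sat-true eq (Unit-ext e≗ e≗∅)
  Sat-ext e≗ (sat-dec0 x c₀ c₁ eq h) = sat-dec0 x c₀ c₁ eq (⊗-ext e≗ h)
  Sat-ext e≗ (sat-dec1 x c₀ c₁ eq h) = sat-dec1 x c₀ c₁ eq (⊗-ext e≗ h)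
  Sat-ext e≗ (sat-conj c₀ c₁ eq h) = sat-conj c₀ c₁ eq (⊗-ext e≗ h)

  ProdSat-dom : ∀ L {p y v} → ProdSat L p → p y ≡ just v → Σ (Fin n) λ w → w ∈ L × VarB w y
  ProdSat-dom [] p≗∅ e = ⊥-elim (nothing≢just (trans (sym (p≗∅ _)) e))
  ProdSat-dom (w ∷ L) {y = y} {v} (_ , _ , hs , hr , u) e with proj₁ (u y v) e
  ... | inj₁ e₁ = w , here refl , proj₁ (Sat-dom hs y) (v , e₁)
  ... | inj₂ e₂ = let (w' , w'∈L , y∈w') = ProdSat-dom L hr e₂ in w' , there w'∈L , y∈w'

  PathVar⊆VarB : ∀ {u v y} (P : Path u v) → PathVar P y → VarB u y
  PathVar⊆VarB (decS _ _ _ eq _ _ ◅ p) (inj₁ refl) = VarB-here eq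
  PathVar⊆VarB (s@(decS _ _ _ _ _ _) ◅ p) (inj₂ h) = VarB-step s (PathVar⊆VarB p h)
  PathVar⊆VarB (s@(conjL _ _ _ _) ◅ p) h = VarB-step s (PathVar⊆VarB p h)
  PathVar⊆VarB (s@(conjR _ _ _ _) ◅ p) h = VarB-step s (PathVar⊆VarB p h)

  pathAssign⇒PathVar : ∀ {u v y b} (P : Path u v) → pathAssign P y ≡ just b → PathVar P y
  pathAssign⇒PathVar ε ()
  pathAssign⇒PathVar {y = y} (decS x _ _ _ _ _ ◅ p) e with x ≟ y
  ... | yes x≡y = inj₁ x≡y
  ... | no _ = inj₂ (pathAssign⇒PathVar p e)
  pathAssign⇒PathVar (conjL _ _ _ _ ◅ p) e = pathAssign⇒PathVar p e
  pathAssign⇒PathVar (conjR _ _ _ _ ◅ p) e = pathAssign⇒PathVar p e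

  pathAssign⊆VarB : ∀ {u v} (P : Path u v) y b → pathAssign P y ≡ just b → VarB u y
  pathAssign⊆VarB P _ _ = PathVar⊆VarB P ∘ pathAssign⇒PathVar P

  pathAssign-here : ∀ {u w v x c₀ c₁ b} (eq : node u ≡ dec x c₀ c₁) (r : w ≡ (if b then c₁ else c₀))
                    (p : Path w v) → pathAssign (decS x c₀ c₁ eq b r ◅ p) x ≡ just b
  pathAssign-here {x = x} eq r p with x ≟ x
  ... | yes _ = refl
  ... | no x≢x = ⊥-elim (x≢x refl)

  pathAssign-there : ∀ {u w v x c₀ c₁ b y} (eq : node u ≡ dec x c₀ c₁) (r : w ≡ (if b then c₁ else c₀))
                     (p : Path w v) → x ≢ y → pathAssign (decS x c₀ c₁ eq b r ◅ p) y ≡ pathAssign p y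
  pathAssign-there {x = x} {y = y} eq r p x≢y with x ≟ y
  ... | yes x≡y = ⊥-elim (x≢y x≡y)
  ... | no _ = refl

  Alt-reachable : ∀ {u v w} (P : Path u v) → w ∈ Alt P → Path u w
  Alt-reachable (s@(decS _ _ _ _ _ _) ◅ p) i = s ◅ Alt-reachable p i
  Alt-reachable (conjL c₀ c₁ eq _ ◅ p) (here refl) = conjR c₀ c₁ eq refl ◅ ε
  Alt-reachable (s@(conjL _ _ _ _) ◅ p) (there i) = s ◅ Alt-reachable p i
  Alt-reachable (conjR c₀ c₁ eq _ ◅ p) (here refl) = conjL c₀ c₁ eq refl ◅ ε
  Alt-reachable (s@(conjR _ _ _ _) ◅ p) (there i) = s ◅ Alt-reachable p i

  Restricted : Fin n → Assign m → AssignSet m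
  Restricted u = Restrict (VarB u) (Sat u)

  Restricted-ext : ∀ {u a} → Extensional (Restricted u a)
  Restricted-ext c≗c' (e , he , a⊆e , c≗) = e , he , a⊆e , λ y → trans (sym (c≗c' y)) (c≗ y)

  restrict-∅ : ∀ {u} → Restricted u ∅ₐ ≐ Sat u
  restrict-∅ c = (λ (e , he , _ , c≗) → Sat-ext (λ y → trans (sym (∖ₐ-∅ e y)) (sym (c≗ y))) he)
               , (λ hc → c , hc , (λ _ _ _ ()) , λ y → sym (∖ₐ-∅ c y))

  module JunctionStep {u w o} (J : Junction u w o) (a : Assign m)
                      (a⊆w : ∀ y v → a y ≡ just v → VarB w y) where
    open Junction J

    alt-disjoint : ∀ {s} → Sat o s → Disjoint a s
    alt-disjoint hs y v ay = Dom-∉ (Sat-dom hs) y (disjoint (a⊆w y v ay))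

    follow : ∀ {e s₀ s₁} → Sat o s₁ → IsUnion e s₀ s₁ → ProjSub a (VarB u) e → ProjSub a (VarB w) s₀
    follow h₁ e-union ps y v y∈w ay with proj₁ (e-union y v) (ps y v (VarB-step step y∈w) ay)
    ... | inj₁ e₀ = e₀
    ... | inj₂ e₁ = ⊥-elim (nothing≢just (trans (sym (alt-disjoint h₁ y v ay)) e₁))

    restrict-isUnion : ∀ {e s₀ s₁} → Sat o s₁ → IsUnion e s₀ s₁ → IsUnion (e ∖ₐ a) (s₀ ∖ₐ a) s₁
    restrict-isUnion h₁ e-union =
      IsUnion-resp (λ _ → refl) (λ _ → refl) (∖ₐ-disjoint (alt-disjoint h₁)) (∖ₐ-isUnion a e-union)

    restrict-junction : Restricted u a ≐ (Restricted w a ⊗ Sat o)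
    restrict-junction c = to , from
      where
      to : Restricted u a c → (Restricted w a ⊗ Sat o) c
      to (e , he , ps , c≗) =
        let (s₀ , s₁ , h₀ , h₁ , e-union) = sat⇒ he in
        s₀ ∖ₐ a , s₁ , (s₀ , h₀ , follow h₁ e-union ps , λ _ → refl) , h₁ ,
        IsUnion-resp (sym ∘ c≗) (λ _ → refl) (λ _ → refl) (restrict-isUnion h₁ e-union)
      from : (Restricted w a ⊗ Sat o) c → Restricted u a c
      from (c₀ , s₁ , (s₀ , h₀ , ps₀ , c₀≗) , h₁ , c-union) =
        s₀ ∪ₐ s₁ , sat⇐ (s₀ , s₁ , h₀ , h₁ , s-union) , (λ y v _ ay → IsUnion-⊆ˡ s-union y v (ps₀ y v (a⊆w y v ay) ay)) ,
        λ y → sym (IsUnion-unique (IsUnion-resp (λ _ → refl) (sym ∘ c₀≗) (λ _ → refl) (restrict-isUnion h₁ s-union)) c-union y)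
        where
        s-union = ∪ₐ-isUnion (disjoint-compatible λ y v e →
               Dom-∉ (Sat-dom h₁) y (disjoint (proj₁ (Sat-dom h₀ y) (v , e))))

    junction-witness : ∀ {e} → Sat u e → a ⊆ₐ e → Σ (Assign m) λ s → Sat w s × a ⊆ₐ s
    junction-witness he a⊆e =
      let (s₀ , s₁ , h₀ , h₁ , e-union) = sat⇒ he in
      s₀ , h₀ , λ y v ay → follow h₁ e-union (λ y v _ → a⊆e y v) y v (a⊆w y v ay) ay

  module DecisionStep {u w o x b} (D : Decision u w o x b) {a a' : Assign m}
                      (ax : a x ≡ just b) (a≡a' : ∀ {y} → x ≢ y → a y ≡ a' y)
                      (a'⊆w : ∀ y v → a' y ≡ just v → VarB w y) where
    open Decision D

    x≢ : ∀ {y} → VarB w y → x ≢ y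
    x≢ y∈w refl = ∉w y∈w

    single⊆a : ∀ {sg} → sg ≗ₐ single x b → sg ⊆ₐ a
    single⊆a sg≗ y v e with single-just (trans (sym (sg≗ y)) e)
    ... | refl , refl = ax

    alt-disjoint : ∀ {k} → Cube (VarDiff o w) k → Disjoint a k
    alt-disjoint dk y v ay with x ≟ y
    ... | yes refl = Dom-∉ dk x (∉o ∘ proj₁)
    ... | no x≢y = Dom-∉ dk y (λ (_ , y∉w) → y∉w (a'⊆w y v (trans (sym (a≡a' x≢y)) ay)))

    restrict-isUnion : ∀ {e sg sk s k} → IsUnion e sg sk → sg ≗ₐ single x b → IsUnion sk s k →
                       Cube (VarB w) s → Cube (VarDiff o w) k → IsUnion (e ∖ₐ a) (s ∖ₐ a') k
    restrict-isUnion {s = s} u₁ sg≗ u₂ ds dk =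
      IsUnion-resp (λ y → sym (IsUnion-∅ˡ (∖ₐ-⊆ (single⊆a sg≗)) (∖ₐ-isUnion a u₁) y))
                   (∖ₐ-cong s (λ y (v , e) → a≡a' (x≢ (proj₁ (ds y) (v , e)))))
                   (∖ₐ-disjoint (alt-disjoint dk))
                   (∖ₐ-isUnion a u₂)

    follow : ∀ {e sg sk s k} → IsUnion e sg sk → sg ≗ₐ single x b → IsUnion sk s k →
             Cube (VarDiff o w) k → ProjSub a (VarB u) e → ProjSub a' (VarB w) s
    follow u₁ sg≗ u₂ dk ps y v y∈w a'y
      with proj₁ (u₁ y v) (ps y v (VarB-step step y∈w) (trans (a≡a' (x≢ y∈w)) a'y))
    ... | inj₁ eg = ⊥-elim (x≢ y∈w (proj₁ (single-just (trans (sym (sg≗ y)) eg))))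
    ... | inj₂ ek with proj₁ (u₂ y v) ek
    ...   | inj₁ es = es
    ...   | inj₂ ek' = ⊥-elim (proj₂ (proj₁ (dk y) (v , ek')) y∈w)

    restrict-decision : Restricted u a ≐ (Restricted w a' ⊗ Cube (VarDiff o w))
    restrict-decision c = to , from
      where
      to : Restricted u a c → (Restricted w a' ⊗ Cube (VarDiff o w)) c
      to (e , he , ps , c≗) =
        let (sg , sk , sg≗ , (s , k , hs , dk , u₂) , u₁) = sat⇒ he (ps x b tested ax) in
        s ∖ₐ a' , k , (s , hs , follow u₁ sg≗ u₂ dk ps , λ _ → refl) , dk ,
        IsUnion-resp (sym ∘ c≗) (λ _ → refl) (λ _ → refl) (restrict-isUnion u₁ sg≗ u₂ (Sat-dom hs) dk)
      from : (Restricted w a' ⊗ Cube (VarDiff o w)) c → Restricted u a c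
      from (c₁ , k , (s , hs , ps' , c₁≗) , dk , c-union) =
        e , sat⇐ (single x b , sk , (λ _ → refl) , (s , k , hs , dk , u₂) , u₁) , ps ,
        λ y → sym (IsUnion-unique (IsUnion-resp (λ _ → refl) (sym ∘ c₁≗) (λ _ → refl)
                                    (restrict-isUnion u₁ (λ _ → refl) u₂ (Sat-dom hs) dk)) c-union y)
        where
        sk = s ∪ₐ k
        u₂ : IsUnion sk s k
        u₂ = ∪ₐ-isUnion (disjoint-compatible λ y v e →
               Dom-∉ dk y (λ (_ , y∉w) → y∉w (proj₁ (Sat-dom hs y) (v , e))))
        x∉sk : sk x ≡ nothing
        x∉sk = Dom-∉ (Dom-isUnion u₂ (Sat-dom hs) dk) x [ ∉w , ∉o ∘ proj₁ ]
        e = single x b ∪ₐ sk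
        u₁ : IsUnion e (single x b) sk
        u₁ = ∪ₐ-isUnion (disjoint-compatible λ y v e → subst (λ z → sk z ≡ nothing) (proj₁ (single-just e)) x∉sk)
        ps : ProjSub a (VarB u) e
        ps y v _ ay = by-cases (x ≟ y)
          where
          by-cases : Dec (x ≡ y) → e y ≡ just v
          by-cases (yes refl) = subst (λ z → e x ≡ just z) (just-injective (trans (sym ax) ay))
                                      (IsUnion-⊆ˡ u₁ x b (single-at x b))
          by-cases (no x≢y) = IsUnion-⊆ʳ u₁ y v (IsUnion-⊆ˡ u₂ y v (ps' y v (a'⊆w y v a'y) a'y))
            where a'y = trans (sym (a≡a' x≢y)) ay

    decision-witness : ∀ {e} → Sat u e → a ⊆ₐ e → Σ (Assign m) λ s → Sat w s × a' ⊆ₐ s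
    decision-witness he a⊆e =
      let (sg , sk , sg≗ , (s , k , hs , dk , u₂) , u₁) = sat⇒ he (a⊆e x b ax) in
      s , hs , λ y v a'y → follow u₁ sg≗ u₂ dk (λ y v _ → a⊆e y v) y v (a'⊆w y v a'y) a'y

  FreeVars : Fin n → Fin n → List (Fin n) → VarSet m → VarSet m
  FreeVars u v alts fixed y = (VarB u y × ¬ VarB v y × (∀ w → w ∈ alts → ¬ VarB w y)) × ¬ fixed y

  Factored : ∀ {u v} → Path u v → AssignSet m
  Factored {u} {v} P = Sat v ⊗ ProdSat (Alt P) ⊗ Cube (FreeVars u v (Alt P) (PathVar P))

  restrict-along-junction : ∀ {u w o v} → Junction u w o → (P : Path w v) →
    Restricted w (pathAssign P) ≐ Factored P →
    Restricted u (pathAssign P) ≐ (Sat v ⊗ ProdSat (o ∷ Alt P) ⊗ Cube (FreeVars u v (o ∷ Alt P) (PathVar P)))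
  restrict-along-junction {u} {w} {o} {v} J P restrict-P = begin
    Restricted u (pathAssign P)                                      ≈⟨ restrict-junction ⟩
    Restricted w (pathAssign P) ⊗ Sat o                              ≈⟨ ⊗-congʳ restrict-P ⟩
    (Sat v ⊗ ProdSat (Alt P) ⊗ Cube (FreeVars w v (Alt P) fixed)) ⊗ Sat o ≈⟨ ⊗-rotate ⟩
    Sat v ⊗ ProdSat (o ∷ Alt P) ⊗ Cube (FreeVars w v (Alt P) fixed)   ≈⟨ ⊗-congˡ (⊗-congˡ (Cube-⇔ to from)) ⟩
    Sat v ⊗ ProdSat (o ∷ Alt P) ⊗ Cube (FreeVars u v (o ∷ Alt P) fixed) ∎
    where
    open Junction J
    open JunctionStep J (pathAssign P) (pathAssign⊆VarB P)
    open ≐-Reasoning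
    fixed = PathVar P
    to : ∀ y → FreeVars w v (Alt P) fixed y → FreeVars u v (o ∷ Alt P) fixed y
    to y ((y∈w , y∉v , y∉alts) , y∉P) = (VarB-step step y∈w , y∉v , y∉alts') , y∉P
      where
      y∉alts' : ∀ w' → w' ∈ o ∷ Alt P → ¬ VarB w' y
      y∉alts' _ (here refl) = disjoint y∈w
      y∉alts' w' (there i) = y∉alts w' i
    from : ∀ y → FreeVars u v (o ∷ Alt P) fixed y → FreeVars w v (Alt P) fixed y
    from y ((y∈u , y∉v , y∉alts) , y∉P) with vars y∈u
    ... | inj₁ y∈w = (y∈w , y∉v , λ w' i → y∉alts w' (there i)) , y∉P
    ... | inj₂ y∈o = ⊥-elim (y∉alts o (here refl) y∈o)

  restrict-along-decision : ∀ {u w o v x b} → Decision u w o x b → (P : Path w v) {a : Assign m} →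
    a x ≡ just b → (∀ {y} → x ≢ y → a y ≡ pathAssign P y) → (∀ y → Dec (VarB w y)) →
    Restricted w (pathAssign P) ≐ Factored P →
    Restricted u a ≐ (Sat v ⊗ ProdSat (Alt P) ⊗ Cube (FreeVars u v (Alt P) (λ y → x ≡ y ⊎ PathVar P y)))
  restrict-along-decision {u} {w} {o} {v} {x} D P {a} ax a≡a' w? restrict-P = begin
    Restricted u a                                                    ≈⟨ restrict-decision ⟩
    Restricted w (pathAssign P) ⊗ Cube (VarDiff o w)                  ≈⟨ ⊗-congʳ restrict-P ⟩
    (Sat v ⊗ ProdSat (Alt P) ⊗ Cube Free-below) ⊗ Cube (VarDiff o w)  ≈⟨ ⊗-assoc ⟩
    Sat v ⊗ (ProdSat (Alt P) ⊗ Cube Free-below) ⊗ Cube (VarDiff o w)  ≈⟨ ⊗-congˡ ⊗-assoc ⟩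
    Sat v ⊗ ProdSat (Alt P) ⊗ Cube Free-below ⊗ Cube (VarDiff o w)    ≈⟨ ⊗-congˡ (⊗-congˡ (≐-sym free-split)) ⟩
    Sat v ⊗ ProdSat (Alt P) ⊗ Cube Free                               ∎
    where
    open Decision D
    open DecisionStep D ax (λ {y} → a≡a' {y}) (pathAssign⊆VarB P)
    open ≐-Reasoning
    Free-below = FreeVars w v (Alt P) (PathVar P)
    Free = FreeVars u v (Alt P) (λ y → x ≡ y ⊎ PathVar P y)
    in-to : ∀ y → Free y × VarB w y → Free-below y
    in-to y (((_ , y∉v , y∉alts) , y∉P) , y∈w) = (y∈w , y∉v , y∉alts) , y∉P ∘ inj₂
    in-from : ∀ y → Free-below y → Free y × VarB w y
    in-from y ((y∈w , y∉v , y∉alts) , y∉P) = ((VarB-step step y∈w , y∉v , y∉alts) , [ x≢ y∈w , y∉P ]) , y∈w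
    out-to : ∀ y → Free y × ¬ VarB w y → VarDiff o w y
    out-to y (((y∈u , _) , y∉P) , y∉w) with vars y∈u
    ... | inj₁ x≡y = ⊥-elim (y∉P (inj₁ x≡y))
    ... | inj₂ (inj₁ y∈w) = ⊥-elim (y∉w y∈w)
    ... | inj₂ (inj₂ y∈o) = y∈o , y∉w
    out-from : ∀ y → VarDiff o w y → Free y × ¬ VarB w y
    out-from y (y∈o , y∉w) =
      ((VarB-step alt-step y∈o , y∉w ∘ VarB-path P , λ w' i → y∉w ∘ VarB-path (Alt-reachable P i)) ,
       [ (λ { refl → ∉o y∈o }) , y∉w ∘ PathVar⊆VarB P ]) , y∉w
    free-split : Cube Free ≐ (Cube Free-below ⊗ Cube (VarDiff o w))
    free-split = ≐-trans (Cube-split w?) (⊗-cong (Cube-⇔ in-to in-from) (Cube-⇔ out-to out-from))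

  -- A satisfying extension of a(P) is carried along the path only to decide
  -- membership in Var(B_w): its restriction to B_w has domain exactly Var(B_w).
  restrict-path : ∀ {u v} (P : Path u v) {e} → Sat u e → pathAssign P ⊆ₐ e →
                  Restricted u (pathAssign P) ≐ Factored P
  restrict-path {u} ε _ _ = begin
    Restricted u ∅ₐ                 ≈⟨ restrict-∅ ⟩
    Sat u                           ≈⟨ ≐-sym (⊗-identityʳ Sat-ext) ⟩
    Sat u ⊗ Unit                    ≈⟨ ⊗-congˡ (≐-sym (⊗-identityʳ Unit-ext)) ⟩
    Sat u ⊗ Unit ⊗ Unit             ≈⟨ ⊗-congˡ (⊗-congˡ (≐-sym (Cube-∅ λ _ ((y∈u , y∉u , _) , _) → y∉u y∈u))) ⟩
    Sat u ⊗ Unit ⊗ Cube (FreeVars u u [] (λ _ → ⊥)) ∎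
    where open ≐-Reasoning
  restrict-path (conjL c₀ c₁ eq refl ◅ P) he a⊆e =
    let (s , hs , a⊆s) = JunctionStep.junction-witness (junctionˡ eq) _ (pathAssign⊆VarB P) he a⊆e in
    restrict-along-junction (junctionˡ eq) P (restrict-path P hs a⊆s)
  restrict-path (conjR c₀ c₁ eq refl ◅ P) he a⊆e =
    let (s , hs , a⊆s) = JunctionStep.junction-witness (junctionʳ eq) _ (pathAssign⊆VarB P) he a⊆e in
    restrict-along-junction (junctionʳ eq) P (restrict-path P hs a⊆s)
  restrict-path (decS x c₀ c₁ eq b refl ◅ P) he a⊆e =
    let (s , hs , a'⊆s) = DecisionStep.decision-witness (decision eq b) ax (λ {y} → a≡a' {y}) (pathAssign⊆VarB P) he a⊆e in
    restrict-along-decision (decision eq b) P ax (λ {y} → a≡a' {y}) (Dom-dec (Sat-dom hs)) (restrict-path P hs a'⊆s)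
    where
    ax = pathAssign-here eq refl P
    a≡a' : ∀ {y} → x ≢ y → _
    a≡a' = pathAssign-there eq refl P

  Factored-flip : ∀ {u v} (P : Path u v) {x} → FreeVars u v (Alt P) (PathVar P) x →
                  ∀ c → Factored P c → Factored P (flip x c)
  Factored-flip P {x} ((_ , x∉v , x∉alts) , _) =
    flip-⊗ʳ x (λ _ hs → Dom-∉ (Sat-dom hs) x x∉v)
      (flip-⊗ʳ x (λ _ hp → ≢just⇒nothing _ λ _ e → let (w , i , x∈w) = ProdSat-dom (Alt P) hp e in x∉alts w i x∈w)
                 (λ _ → flip-Dom x))

  ⊗-ProdSat-[] : ∀ {L} {A C : AssignSet m} → Extensional C → L ≡ [] → (A ⊗ ProdSat L ⊗ C) ≐ (A ⊗ C)
  ⊗-ProdSat-[] ext refl = ⊗-congˡ (⊗-identityˡ ext)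

open Assignments
open Diagram

theorem2 : ∀ {n m} (B : FBDD n m) {v} (P : Graph.Path (FBDD.node B) (FBDD.source B) v) →
  Σ (Assign m) (λ b → SB B b × (Graph.pathAssign (FBDD.node B) P ⊆ₐ b)) →
  (∀ x → V₀ B P x → ¬ Graph.PathVar (FBDD.node B) P x →
     Inessential (VarRestr B (Graph.pathAssign (FBDD.node B) P)) (SRestr B (Graph.pathAssign (FBDD.node B) P)) x)
  × (Graph.Alt (FBDD.node B) P ≢ [] →
     SRestr B (Graph.pathAssign (FBDD.node B) P)
       ≐ (Graph.Sat (FBDD.node B) v ⊗ Graph.ProdSat (FBDD.node B) (Graph.Alt (FBDD.node B) P)
            ⊗ Cube (λ x → V₀ B P x × ¬ Graph.PathVar (FBDD.node B) P x)))
  × (Graph.Alt (FBDD.node B) P ≡ [] →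
     SRestr B (Graph.pathAssign (FBDD.node B) P)
       ≐ (Graph.Sat (FBDD.node B) v ⊗ Cube (λ x → V₀ B P x × ¬ Graph.PathVar (FBDD.node B) P x)))
theorem2 B P (e , he , a⊆e) =
  inessential , (λ _ → factorisation) , (λ Alt≡[] → ≐-trans factorisation (⊗-ProdSat-[] B Cube-ext Alt≡[]))
  where
  factorisation = restrict-path B P he a⊆e
  inessential : _
  inessential x x∈V₀ x∉P = flip-closed⇒inessential (Restricted-ext B)
    (λ c → proj₂ (factorisation (flip x c)) ∘ Factored-flip B P (x∈V₀ , x∉P) c ∘ proj₁ (factorisation c))
    (proj₁ x∈V₀ , λ (_ , ax) → x∉P (pathAssign⇒PathVar B P ax))
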